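{- Let $(\mathcal C,\otimes,I,\gamma)$ be a symmetric monoidal category and $(\mathcal T,\eta,\mu,\tau)$ a strong monad on it that is centralisable, and for each object $X$ let $(\mathcal ZX,\iota_X)$ be a terminal central cone of $\mathcal T$ at $X$. Then the assignment $X\mapsto\mathcal ZX$ extends to a commutative monad $(\mathcal Z,\eta^{\mathcal Z},\mu^{\mathcal Z},\tau^{\mathcal Z})$ on $\mathcal C$. Moreover, $\mathcal Z$ is a commutative submonad of $\mathcal T$, and the morphisms $\iota_X:\mathcal ZX\to\mathcal TX$ constitute a monomorphism of strong monads $\iota:\mathcal Z\Rightarrow\mathcal T$.
   Context: Left strength $\tau_{X,Y}:X\otimes\mathcal TY\to\mathcal T(X\otimes Y)$; right strength $\tau'_{X,Y}=\mathcal T(\gamma_{Y,X})\circ\tau_{Y,X}\circ\gamma_{\mathcal TX,Y}$. A strong monad is commutative if $\mu\circ\mathcal T\tau'\circ\tau=\mu\circ\mathcal T\tau\circ\tau':\mathcal TX\otimes\mathcal TY\to\mathcal T(X\otimes Y)$ for all $X,Y$. A central cone of $\mathcal T$ at $X$ is a pair $(Z,\iota)$, $\iota:Z\to\mathcal TX$, such that for every object $Y$, $\mu\circ\mathcal T\tau'_{X,Y}\circ\tau_{\mathcal TX,Y}\circ(\iota\otimes\mathcal TY)=\mu\circ\mathcal T\tau_{X,Y}\circ\tau'_{X,\mathcal TY}\circ(\iota\otimes\mathcal TY):Z\otimes\mathcal TY\to\mathcal T(X\otimes Y)$. A morphism of central cones $(Z',\iota')\to(Z,\iota)$ is $\varphi:Z'\to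 Z$ with $\iota\circ\varphi=\iota'$; a terminal central cone at $X$ is a terminal object in this category. $\mathcal T$ is centralisable if a terminal central cone exists at every object. A morphism of strong monads $\iota:\mathcal S\Rightarrow\mathcal T$ is a natural transformation with $\iota\circ\eta^{\mathcal S}=\eta^{\mathcal T}$, $\iota\circ\mu^{\mathcal S}=\mu^{\mathcal T}\circ\mathcal T\iota\circ\iota_{\mathcal S}$, $\iota\circ\tau^{\mathcal S}_{X,Y}=\tau^{\mathcal T}_{X,Y}\circ(X\otimes\iota_Y)$; a (commutative) submonad of $\mathcal T$ is a (commutative) strong monad $\mathcal S$ with such an $\iota$ that is a monomorphism in the category of strong monads on $\mathcal C$. -}

module Defs where

open import Level using (Level; _⊔_) renaming (suc to lsuc)
open import Data.Product using (Σ; _×_; _,_)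
open import Relation.Binary.Structures using (IsEquivalence)

record SymmetricMonoidalCategory (o ℓ e : Level) : Set (lsuc (o ⊔ ℓ ⊔ e)) where
  infix  4 _≈_
  infixr 9 _∘_
  infixr 10 _⊗₀_ _⊗₁_
  field
    Obj : Set o
    _⇒_ : Obj → Obj → Set ℓ
    _≈_ : ∀ {A B} → A ⇒ B → A ⇒ B → Set e
    ≈-equiv : ∀ {A B} → IsEquivalence (_≈_ {A} {B})
    id  : ∀ {A} → A ⇒ A
    _∘_ : ∀ {A B C} → B ⇒ C → A ⇒ B → A ⇒ C
    ∘-resp-≈ : ∀ {A B C} {f g : B ⇒ C} {h k : A ⇒ B} → f ≈ g → h ≈ k → f ∘ h ≈ g ∘ k
    assoc : ∀ {A B C D} {f : A ⇒ B} {g : B ⇒ C} {h : C ⇒ D} → (h ∘ g) ∘ f ≈ h ∘ (g ∘ f)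
    identityˡ : ∀ {A B} {f : A ⇒ B} → id ∘ f ≈ f
    identityʳ : ∀ {A B} {f : A ⇒ B} → f ∘ id ≈ f

    _⊗₀_ : Obj → Obj → Obj
    _⊗₁_ : ∀ {A B C D} → A ⇒ B → C ⇒ D → (A ⊗₀ C) ⇒ (B ⊗₀ D)
    ⊗-identity : ∀ {A B} → id {A} ⊗₁ id {B} ≈ id
    ⊗-homomorphism : ∀ {A B C D E F} {f : A ⇒ B} {g : B ⇒ C} {h : D ⇒ E} {k : E ⇒ F} →
                     (g ∘ f) ⊗₁ (k ∘ h) ≈ (g ⊗₁ k) ∘ (f ⊗₁ h)
    ⊗-resp-≈ : ∀ {A B C D} {f g : A ⇒ B} {h k : C ⇒ D} → f ≈ g → h ≈ k → f ⊗₁ h ≈ g ⊗₁ k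

    unit : Obj
    unitorˡ⇒ : ∀ {A} → (unit ⊗₀ A) ⇒ A
    unitorˡ⇐ : ∀ {A} → A ⇒ (unit ⊗₀ A)
    unitorˡ-isoˡ : ∀ {A} → unitorˡ⇐ ∘ unitorˡ⇒ {A} ≈ id
    unitorˡ-isoʳ : ∀ {A} → unitorˡ⇒ ∘ unitorˡ⇐ {A} ≈ id
    unitorˡ-natural : ∀ {A B} {f : A ⇒ B} → f ∘ unitorˡ⇒ ≈ unitorˡ⇒ ∘ (id ⊗₁ f)
    unitorʳ⇒ : ∀ {A} → (A ⊗₀ unit) ⇒ A
    unitorʳ⇐ : ∀ {A} → A ⇒ (A ⊗₀ unit)
    unitorʳ-isoˡ : ∀ {A} → unitorʳ⇐ ∘ unitorʳ⇒ {A} ≈ id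
    unitorʳ-isoʳ : ∀ {A} → unitorʳ⇒ ∘ unitorʳ⇐ {A} ≈ id
    unitorʳ-natural : ∀ {A B} {f : A ⇒ B} → f ∘ unitorʳ⇒ ≈ unitorʳ⇒ ∘ (f ⊗₁ id)
    associator⇒ : ∀ {A B C} → ((A ⊗₀ B) ⊗₀ C) ⇒ (A ⊗₀ (B ⊗₀ C))
    associator⇐ : ∀ {A B C} → (A ⊗₀ (B ⊗₀ C)) ⇒ ((A ⊗₀ B) ⊗₀ C)
    associator-isoˡ : ∀ {A B C} → associator⇐ ∘ associator⇒ {A} {B} {C} ≈ id
    associator-isoʳ : ∀ {A B C} → associator⇒ ∘ associator⇐ {A} {B} {C} ≈ id
    associator-natural : ∀ {A B C D E F} {f : A ⇒ D} {g : B ⇒ E} {h : C ⇒ F} →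
                         (f ⊗₁ (g ⊗₁ h)) ∘ associator⇒ ≈ associator⇒ ∘ ((f ⊗₁ g) ⊗₁ h)
    triangle : ∀ {A B} → (id {A} ⊗₁ unitorˡ⇒ {B}) ∘ associator⇒ ≈ unitorʳ⇒ ⊗₁ id
    pentagon : ∀ {A B C D} →
               (id {A} ⊗₁ associator⇒ {B} {C} {D}) ∘ associator⇒ ∘ (associator⇒ ⊗₁ id)
                 ≈ associator⇒ ∘ associator⇒

    braiding : ∀ {A B} → (A ⊗₀ B) ⇒ (B ⊗₀ A)
    braiding-natural : ∀ {A B C D} {f : A ⇒ C} {g : B ⇒ D} →
                       (g ⊗₁ f) ∘ braiding ≈ braiding ∘ (f ⊗₁ g)
    commutative : ∀ {A B} → braiding {B} {A} ∘ braiding {A} {B} ≈ id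
    hexagon : ∀ {A B C} →
              associator⇒ ∘ braiding ∘ associator⇒ {A} {B} {C}
                ≈ (id ⊗₁ braiding) ∘ associator⇒ ∘ (braiding ⊗₁ id)

module _ {o ℓ e} (C : SymmetricMonoidalCategory o ℓ e) where
  open SymmetricMonoidalCategory C

  record StrongMonadOn (F : Obj → Obj) : Set (o ⊔ ℓ ⊔ e) where
    field
      T₁ : ∀ {A B} → A ⇒ B → F A ⇒ F B
      T-identity : ∀ {A} → T₁ (id {A}) ≈ id
      T-homomorphism : ∀ {A B D} {f : A ⇒ B} {g : B ⇒ D} → T₁ (g ∘ f) ≈ T₁ g ∘ T₁ f
      T-resp-≈ : ∀ {A B} {f g : A ⇒ B} → f ≈ g → T₁ f ≈ T₁ g
      η : ∀ {A} → A ⇒ F A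
      η-natural : ∀ {A B} {f : A ⇒ B} → T₁ f ∘ η ≈ η ∘ f
      μ : ∀ {A} → F (F A) ⇒ F A
      μ-natural : ∀ {A B} {f : A ⇒ B} → T₁ f ∘ μ ≈ μ ∘ T₁ (T₁ f)
      μ-assoc : ∀ {A} → μ {A} ∘ T₁ μ ≈ μ ∘ μ
      μ-identityˡ : ∀ {A} → μ {A} ∘ T₁ η ≈ id
      μ-identityʳ : ∀ {A} → μ {A} ∘ η ≈ id
      τ : ∀ {A B} → (A ⊗₀ F B) ⇒ F (A ⊗₀ B)
      τ-natural : ∀ {A B D E} {f : A ⇒ D} {g : B ⇒ E} → T₁ (f ⊗₁ g) ∘ τ ≈ τ ∘ (f ⊗₁ T₁ g)
      τ-unitor : ∀ {A} → T₁ unitorˡ⇒ ∘ τ {unit} {A} ≈ unitorˡ⇒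
      τ-associator : ∀ {A B D} →
                     T₁ associator⇒ ∘ τ {A ⊗₀ B} {D} ≈ τ ∘ (id ⊗₁ τ) ∘ associator⇒
      τ-η : ∀ {A B} → τ {A} {B} ∘ (id ⊗₁ η) ≈ η
      τ-μ : ∀ {A B} → τ {A} {B} ∘ (id ⊗₁ μ) ≈ μ ∘ T₁ τ ∘ τ

  module _ {F : Obj → Obj} (T : StrongMonadOn F) where
    open StrongMonadOn T

    τ' : ∀ {X Y} → (F X ⊗₀ Y) ⇒ F (X ⊗₀ Y)
    τ' {X} {Y} = T₁ (braiding {Y} {X}) ∘ τ {Y} {X} ∘ braiding {F X} {Y}

    IsCommutativeMonad : Set (o ⊔ e)
    IsCommutativeMonad = ∀ {X Y} →
      μ ∘ T₁ (τ' {X} {Y}) ∘ τ {F X} {Y} ≈ μ ∘ T₁ (τ {X} {Y}) ∘ τ' {X} {F Y}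

    IsCentralCone : (X Z : Obj) → Z ⇒ F X → Set (o ⊔ e)
    IsCentralCone X Z ι = ∀ Y →
      μ ∘ T₁ (τ' {X} {Y}) ∘ τ {F X} {Y} ∘ (ι ⊗₁ id {F Y})
        ≈ μ ∘ T₁ (τ {X} {Y}) ∘ τ' {X} {F Y} ∘ (ι ⊗₁ id {F Y})

    IsTerminalCentralCone : (X Z : Obj) → Z ⇒ F X → Set (o ⊔ ℓ ⊔ e)
    IsTerminalCentralCone X Z ι =
      IsCentralCone X Z ι ×
      (∀ (Z' : Obj) (ι' : Z' ⇒ F X) → IsCentralCone X Z' ι' →
        Σ (Z' ⇒ Z) λ φ → (ι ∘ φ ≈ ι') × (∀ (ψ : Z' ⇒ Z) → ι ∘ ψ ≈ ι' → ψ ≈ φ))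

  module _ {F G : Obj → Obj} (S : StrongMonadOn F) (T : StrongMonadOn G) where
    private
      module S = StrongMonadOn S
      module T = StrongMonadOn T

    IsStrongMonadMorphism : (∀ X → F X ⇒ G X) → Set (o ⊔ ℓ ⊔ e)
    IsStrongMonadMorphism θ =
      (∀ {A B} (f : A ⇒ B) → T.T₁ f ∘ θ A ≈ θ B ∘ S.T₁ f) ×
      (∀ {A} → θ A ∘ S.η ≈ T.η) ×
      (∀ {A} → θ A ∘ S.μ ≈ T.μ ∘ T.T₁ (θ A) ∘ θ (F A)) ×
      (∀ {A B} → θ (A ⊗₀ B) ∘ S.τ ≈ T.τ ∘ (id ⊗₁ θ B))

  IsStrongMonadMono : {F G : Obj → Obj} (S : StrongMonadOn F) (T : StrongMonadOn G) →
                      (∀ X → F X ⇒ G X) → Set (o ⊔ ℓ ⊔ e)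
  IsStrongMonadMono {F} S T θ =
    ∀ {H : Obj → Obj} (R : StrongMonadOn H) (f g : ∀ X → H X ⇒ F X) →
      IsStrongMonadMorphism R S f → IsStrongMonadMorphism R S g →
      (∀ X → θ X ∘ f X ≈ θ X ∘ g X) → ∀ X → f X ≈ g X

{-# OPTIONS --safe #-}
-- Call f : A ⇒ T X central when τ'[ f ] • τ[ k ] ≈ τ[ k ] • τ'[ f ] for every Kleisli map k,
-- where • is Kleisli composition and τ[ k ], τ'[ f ] are k and f strengthened on the left and
-- on the right.  The cone condition is the case k = id, and naturality of the strengths gives
-- the general case.  Central maps contain η and are closed under Kleisli composition,
-- precomposition, postcomposition with T₁ g and left strengthening, so T₁ f ∘ ι, η, ι • ι and
-- τ[ ι ] factor uniquely through the terminal central cones: this defines the action, unit,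
-- multiplication and strength of Z.  As ι is monic, every law for Z follows from the same law
-- for T, and commutativity of Z is the centrality of ι itself.
module Submission where

open import Level using (_⊔_)
open import Data.Product using (Σ; _×_; _,_; proj₁; proj₂)
open import Relation.Binary.Bundles using (Setoid)
open import Relation.Binary.Structures using (IsEquivalence)
import Relation.Binary.Reasoning.Setoid as SetoidReasoning

open import Defs

module _ {o ℓ e} (C : SymmetricMonoidalCategory o ℓ e) where
  open SymmetricMonoidalCategory C
    renaming (associator⇒ to α⇒; associator⇐ to α⇐; braiding to γ)

  hom-setoid : Obj → Obj → Setoid ℓ e
  hom-setoid A B = record { Carrier = A ⇒ B ; _≈_ = _≈_ ; isEquivalence = ≈-equiv }

  module _ {A B : Obj} where
    open IsEquivalence (≈-equiv {A} {B}) public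
      using () renaming (refl to ≈-refl; sym to ≈-sym; trans to ≈-trans)
    open SetoidReasoning (hom-setoid A B) public

  infixr 4 _⟩∘⟨_ refl⟩∘⟨_
  infixl 5 _⟩∘⟨refl

  _⟩∘⟨_ : ∀ {A B D} {f g : B ⇒ D} {h k : A ⇒ B} → f ≈ g → h ≈ k → f ∘ h ≈ g ∘ k
  _⟩∘⟨_ = ∘-resp-≈

  refl⟩∘⟨_ : ∀ {A B D} {f : B ⇒ D} {h k : A ⇒ B} → h ≈ k → f ∘ h ≈ f ∘ k
  refl⟩∘⟨ p = ≈-refl ⟩∘⟨ p

  _⟩∘⟨refl : ∀ {A B D} {f g : B ⇒ D} {h : A ⇒ B} → f ≈ g → f ∘ h ≈ g ∘ h
  p ⟩∘⟨refl = p ⟩∘⟨ ≈-refl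

  sym-assoc : ∀ {A B D G} {f : A ⇒ B} {g : B ⇒ D} {h : D ⇒ G} → h ∘ (g ∘ f) ≈ (h ∘ g) ∘ f
  sym-assoc = ≈-sym assoc

  assoc₃⁻ : ∀ {A B D G H} {a : G ⇒ H} {b : D ⇒ G} {c : B ⇒ D} {f : A ⇒ B} →
            a ∘ b ∘ c ∘ f ≈ (a ∘ b ∘ c) ∘ f
  assoc₃⁻ = ≈-trans (refl⟩∘⟨ sym-assoc) sym-assoc

  pullˡ : ∀ {A B D G} {a : D ⇒ G} {b : B ⇒ D} {c : B ⇒ G} {f : A ⇒ B} →
          a ∘ b ≈ c → a ∘ (b ∘ f) ≈ c ∘ f
  pullˡ p = ≈-trans sym-assoc (p ⟩∘⟨refl)

  pullʳ : ∀ {A B D G} {a : B ⇒ D} {b : A ⇒ B} {c : A ⇒ D} {f : D ⇒ G} →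
          a ∘ b ≈ c → (f ∘ a) ∘ b ≈ f ∘ c
  pullʳ p = ≈-trans assoc (refl⟩∘⟨ p)

  extendʳ : ∀ {A B D D' G} {a : D ⇒ G} {b : B ⇒ D} {c : D' ⇒ G} {d : B ⇒ D'} {f : A ⇒ B} →
            a ∘ b ≈ c ∘ d → a ∘ (b ∘ f) ≈ c ∘ (d ∘ f)
  extendʳ p = ≈-trans (pullˡ p) assoc

  extend₃ : ∀ {A B D G H D' G'} {a : G ⇒ H} {b : D ⇒ G} {c : B ⇒ D}
              {a' : G' ⇒ H} {b' : D' ⇒ G'} {c' : B ⇒ D'} {f : A ⇒ B} →
            a ∘ b ∘ c ≈ a' ∘ b' ∘ c' → a ∘ b ∘ c ∘ f ≈ a' ∘ b' ∘ c' ∘ f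
  extend₃ p = ≈-trans assoc₃⁻ (≈-trans (p ⟩∘⟨refl) (≈-sym assoc₃⁻))

  cancelˡ : ∀ {A B D} {a : D ⇒ B} {b : B ⇒ D} {f : A ⇒ B} → a ∘ b ≈ id → a ∘ (b ∘ f) ≈ f
  cancelˡ p = ≈-trans (pullˡ p) identityˡ

  cancelʳ : ∀ {A B D} {a : D ⇒ B} {b : B ⇒ D} {f : B ⇒ A} → a ∘ b ≈ id → (f ∘ a) ∘ b ≈ f
  cancelʳ p = ≈-trans (pullʳ p) identityʳ

  split-mono : ∀ {A B D} {r : B ⇒ A} {s : A ⇒ B} {p q : D ⇒ A} →
               r ∘ s ≈ id → s ∘ p ≈ s ∘ q → p ≈ q
  split-mono {r = r} {s} {p} {q} rs≈id sp≈sq = begin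
    p           ≈⟨ cancelˡ rs≈id ⟨
    r ∘ (s ∘ p) ≈⟨ refl⟩∘⟨ sp≈sq ⟩
    r ∘ (s ∘ q) ≈⟨ cancelˡ rs≈id ⟩
    q           ∎

  serialize₁₂ : ∀ {A B D G} {f : A ⇒ B} {g : D ⇒ G} → f ⊗₁ g ≈ (f ⊗₁ id) ∘ (id ⊗₁ g)
  serialize₁₂ = ≈-trans (⊗-resp-≈ (≈-sym identityʳ) (≈-sym identityˡ)) ⊗-homomorphism

  serialize₂₁ : ∀ {A B D G} {f : A ⇒ B} {g : D ⇒ G} → f ⊗₁ g ≈ (id ⊗₁ g) ∘ (f ⊗₁ id)
  serialize₂₁ = ≈-trans (⊗-resp-≈ (≈-sym identityˡ) (≈-sym identityʳ)) ⊗-homomorphism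

  ⊗-slide : ∀ {A B D G} {f : A ⇒ B} {g : D ⇒ G} → (f ⊗₁ id) ∘ (id ⊗₁ g) ≈ (id ⊗₁ g) ∘ (f ⊗₁ id)
  ⊗-slide = ≈-trans (≈-sym serialize₁₂) serialize₂₁

  id⊗-∘ : ∀ {A B D G} {g : B ⇒ D} {f : A ⇒ B} → id {G} ⊗₁ (g ∘ f) ≈ (id ⊗₁ g) ∘ (id ⊗₁ f)
  id⊗-∘ = ≈-trans (⊗-resp-≈ (≈-sym identityˡ) ≈-refl) ⊗-homomorphism

  ∘-⊗id : ∀ {A B D G} {g : B ⇒ D} {f : A ⇒ B} → (g ∘ f) ⊗₁ id {G} ≈ (g ⊗₁ id) ∘ (f ⊗₁ id)
  ∘-⊗id = ≈-trans (⊗-resp-≈ ≈-refl (≈-sym identityˡ)) ⊗-homomorphism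

  associator-naturalʳ : ∀ {A B D D'} {h : D ⇒ D'} →
                        α⇒ ∘ (id ⊗₁ h) ≈ (id {A} ⊗₁ (id {B} ⊗₁ h)) ∘ α⇒
  associator-naturalʳ = ≈-trans (refl⟩∘⟨ ⊗-resp-≈ (≈-sym ⊗-identity) ≈-refl) (≈-sym associator-natural)

  id⊗γ-involutive : ∀ {A B D} → (id {A} ⊗₁ γ {B} {D}) ∘ (id ⊗₁ γ) ≈ id
  id⊗γ-involutive = ≈-trans (≈-sym id⊗-∘) (≈-trans (⊗-resp-≈ ≈-refl commutative) ⊗-identity)

  hexagon-α⇐ : ∀ {A B Y} → (γ {Y} {A} ⊗₁ id {B}) ∘ α⇐ ∘ γ {A ⊗₀ B} {Y}
                          ≈ α⇐ ∘ (id ⊗₁ γ {B} {Y}) ∘ α⇒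
  hexagon-α⇐ = begin
    (γ ⊗₁ id) ∘ α⇐ ∘ γ                          ≈⟨ cancelˡ associator-isoˡ ⟨
    α⇐ ∘ α⇒ ∘ (γ ⊗₁ id) ∘ α⇐ ∘ γ                ≈⟨ refl⟩∘⟨ pullˡ hexagon′ ⟩
    α⇐ ∘ ((id ⊗₁ γ) ∘ α⇒ ∘ γ ∘ α⇒) ∘ α⇐ ∘ γ    ≈⟨ refl⟩∘⟨ pullʳ (pullʳ (pullʳ (cancelˡ associator-isoʳ))) ⟩
    α⇐ ∘ (id ⊗₁ γ) ∘ α⇒ ∘ γ ∘ γ                ≈⟨ refl⟩∘⟨ refl⟩∘⟨ refl⟩∘⟨ commutative ⟩
    α⇐ ∘ (id ⊗₁ γ) ∘ α⇒ ∘ id                   ≈⟨ refl⟩∘⟨ refl⟩∘⟨ identityʳ ⟩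
    α⇐ ∘ (id ⊗₁ γ) ∘ α⇒                        ∎
    where
    hexagon′ : α⇒ ∘ (γ ⊗₁ id) ≈ (id ⊗₁ γ) ∘ α⇒ ∘ γ ∘ α⇒
    hexagon′ = begin
      α⇒ ∘ (γ ⊗₁ id)                         ≈⟨ cancelˡ id⊗γ-involutive ⟨
      (id ⊗₁ γ) ∘ (id ⊗₁ γ) ∘ α⇒ ∘ (γ ⊗₁ id) ≈⟨ refl⟩∘⟨ hexagon ⟨
      (id ⊗₁ γ) ∘ α⇒ ∘ γ ∘ α⇒                ∎

  module Kleisli {F : Obj → Obj} (T : StrongMonadOn C F) where
    open StrongMonadOn T

    infixr 8 _•_
    _•_ : ∀ {A B X} → B ⇒ F X → A ⇒ F B → A ⇒ F X
    g • f = μ ∘ T₁ g ∘ f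

    •-resp-≈ : ∀ {A B X} {g g' : B ⇒ F X} {f f' : A ⇒ F B} → g ≈ g' → f ≈ f' → g • f ≈ g' • f'
    •-resp-≈ p q = refl⟩∘⟨ T-resp-≈ p ⟩∘⟨ q

    •-∘ : ∀ {A' A B X} {g : B ⇒ F X} {f : A ⇒ F B} {h : A' ⇒ A} → (g • f) ∘ h ≈ g • (f ∘ h)
    •-∘ = ≈-trans assoc (refl⟩∘⟨ assoc)

    •-T₁ : ∀ {A B B' X} {g : B' ⇒ F X} {h : B ⇒ B'} {f : A ⇒ F B} → g • (T₁ h ∘ f) ≈ (g ∘ h) • f
    •-T₁ = refl⟩∘⟨ pullˡ (≈-sym T-homomorphism)

    T₁-• : ∀ {A B X Y} {p : X ⇒ Y} {g : B ⇒ F X} {f : A ⇒ F B} → T₁ p ∘ (g • f) ≈ (T₁ p ∘ g) • f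
    T₁-• {p = p} {g} {f} = begin
      T₁ p ∘ μ ∘ T₁ g ∘ f        ≈⟨ pullˡ μ-natural ⟩
      (μ ∘ T₁ (T₁ p)) ∘ T₁ g ∘ f ≈⟨ pullʳ (pullˡ (≈-sym T-homomorphism)) ⟩
      μ ∘ T₁ (T₁ p ∘ g) ∘ f      ∎

    •-identityˡ : ∀ {A X} {f : A ⇒ F X} → η • f ≈ f
    •-identityˡ = ≈-trans (pullˡ μ-identityˡ) identityˡ

    •-identityʳ : ∀ {B X} {g : B ⇒ F X} → g • η ≈ g
    •-identityʳ = ≈-trans (refl⟩∘⟨ η-natural) (cancelˡ μ-identityʳ)

    pure-• : ∀ {A B X} {p : B ⇒ X} {f : A ⇒ F B} → (η ∘ p) • f ≈ T₁ p ∘ f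
    pure-• = ≈-trans (≈-sym •-T₁) •-identityˡ

    •-pure : ∀ {A B X} {g : B ⇒ F X} {p : A ⇒ B} → g • (η ∘ p) ≈ g ∘ p
    •-pure = ≈-trans (≈-sym •-∘) (•-identityʳ ⟩∘⟨refl)

    T-homomorphism₃ : ∀ {A B D G} {f : D ⇒ G} {g : B ⇒ D} {h : A ⇒ B} →
                      T₁ (f ∘ g ∘ h) ≈ T₁ f ∘ T₁ g ∘ T₁ h
    T-homomorphism₃ = ≈-trans T-homomorphism (refl⟩∘⟨ T-homomorphism)

    •-assoc : ∀ {A B D X} {h : D ⇒ F X} {g : B ⇒ F D} {f : A ⇒ F B} → (h • g) • f ≈ h • (g • f)
    •-assoc {h = h} {g} {f} = begin
      (h • g) • f                  ≈⟨ •-T₁ ⟨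
      μ • (T₁ (T₁ h ∘ g) ∘ f)      ≈⟨ pullˡ μ-assoc ⟩
      (μ ∘ μ) ∘ T₁ (T₁ h ∘ g) ∘ f  ≈⟨ assoc ⟩
      μ ∘ ((T₁ h ∘ g) • f)         ≈⟨ refl⟩∘⟨ T₁-• ⟨
      h • (g • f)                  ∎

  module Strength {F : Obj → Obj} (T : StrongMonadOn C F) where
    open StrongMonadOn T
    open Kleisli T

    τ[_] : ∀ {A B X} → B ⇒ F X → (A ⊗₀ B) ⇒ F (A ⊗₀ X)
    τ[ f ] = τ ∘ (id ⊗₁ f)

    τ'[_] : ∀ {A B X} → B ⇒ F X → (B ⊗₀ A) ⇒ F (X ⊗₀ A)
    τ'[ f ] = τ' C T ∘ (f ⊗₁ id)

    τ[]-resp-≈ : ∀ {A B X} {f g : B ⇒ F X} → f ≈ g → τ[_] {A} f ≈ τ[ g ]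
    τ[]-resp-≈ p = refl⟩∘⟨ ⊗-resp-≈ ≈-refl p

    τ'[]-resp-≈ : ∀ {A B X} {f g : B ⇒ F X} → f ≈ g → τ'[_] {A} f ≈ τ'[ g ]
    τ'[]-resp-≈ p = refl⟩∘⟨ ⊗-resp-≈ p ≈-refl

    τ[id] : ∀ {A X} → τ[_] {A} (id {F X}) ≈ τ
    τ[id] = ≈-trans (refl⟩∘⟨ ⊗-identity) identityʳ

    τ[]-∘ : ∀ {A B B' X} {g : B ⇒ F X} {p : B' ⇒ B} → τ[_] {A} g ∘ (id ⊗₁ p) ≈ τ[ g ∘ p ]
    τ[]-∘ = ≈-trans assoc (refl⟩∘⟨ ≈-sym id⊗-∘)

    τ-naturalˡ : ∀ {A A' B} {h : A ⇒ A'} → τ {A'} {B} ∘ (h ⊗₁ id) ≈ T₁ (h ⊗₁ id) ∘ τ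
    τ-naturalˡ = ≈-trans (refl⟩∘⟨ ⊗-resp-≈ ≈-refl (≈-sym T-identity)) (≈-sym τ-natural)

    τ[]-naturalˡ : ∀ {A A' B X} {k : B ⇒ F X} {h : A ⇒ A'} → τ[ k ] ∘ (h ⊗₁ id) ≈ T₁ (h ⊗₁ id) ∘ τ[ k ]
    τ[]-naturalˡ {k = k} {h} = begin
      (τ ∘ (id ⊗₁ k)) ∘ (h ⊗₁ id)   ≈⟨ assoc ⟩
      τ ∘ (id ⊗₁ k) ∘ (h ⊗₁ id)     ≈⟨ refl⟩∘⟨ ⊗-slide ⟨
      τ ∘ (h ⊗₁ id) ∘ (id ⊗₁ k)     ≈⟨ extendʳ τ-naturalˡ ⟩
      T₁ (h ⊗₁ id) ∘ τ[ k ]         ∎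

    τ[]-• : ∀ {A B D X} {g : D ⇒ F X} {f : B ⇒ F D} → τ[_] {A} (g • f) ≈ τ[ g ] • τ[ f ]
    τ[]-• {g = g} {f} = begin
      τ ∘ (id ⊗₁ (μ ∘ T₁ g ∘ f))                 ≈⟨ refl⟩∘⟨ ≈-trans id⊗-∘ (refl⟩∘⟨ id⊗-∘) ⟩
      τ ∘ (id ⊗₁ μ) ∘ (id ⊗₁ T₁ g) ∘ (id ⊗₁ f)   ≈⟨ pullˡ τ-μ ⟩
      (μ ∘ T₁ τ ∘ τ) ∘ (id ⊗₁ T₁ g) ∘ (id ⊗₁ f)  ≈⟨ pullʳ (pullʳ (extendʳ (≈-sym τ-natural))) ⟩
      μ ∘ T₁ τ ∘ T₁ (id ⊗₁ g) ∘ τ[ f ]           ≈⟨ •-T₁ ⟩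
      τ[ g ] • τ[ f ]                            ∎

    τ[]-via-τ[id] : ∀ {A B X} {k : B ⇒ F X} → τ[_] {A} k ≈ τ[ id ] ∘ (id ⊗₁ k)
    τ[]-via-τ[id] = ≈-sym (≈-trans τ[]-∘ (τ[]-resp-≈ identityˡ))

    τ[]-pure : ∀ {A B X} {h : B ⇒ X} → τ[_] {A} (η ∘ h) ≈ η ∘ (id ⊗₁ h)
    τ[]-pure = ≈-trans (refl⟩∘⟨ id⊗-∘) (pullˡ τ-η)

    τ'[]-via-τ[] : ∀ {A B X} {f : B ⇒ F X} → τ'[_] {A} f ≈ T₁ γ ∘ τ[ f ] ∘ γ
    τ'[]-via-τ[] {f = f} = begin
      (T₁ γ ∘ τ ∘ γ) ∘ (f ⊗₁ id)   ≈⟨ pullʳ assoc ⟩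
      T₁ γ ∘ τ ∘ γ ∘ (f ⊗₁ id)     ≈⟨ refl⟩∘⟨ refl⟩∘⟨ braiding-natural ⟨
      T₁ γ ∘ τ ∘ (id ⊗₁ f) ∘ γ     ≈⟨ refl⟩∘⟨ sym-assoc ⟩
      T₁ γ ∘ τ[ f ] ∘ γ            ∎

    τ'[]-• : ∀ {A B D X} {g : D ⇒ F X} {f : B ⇒ F D} → τ'[_] {A} (g • f) ≈ τ'[ g ] • τ'[ f ]
    τ'[]-• {g = g} {f} = begin
      τ'[ g • f ]                                   ≈⟨ τ'[]-via-τ[] ⟩
      T₁ γ ∘ τ[ g • f ] ∘ γ                         ≈⟨ refl⟩∘⟨ τ[]-• ⟩∘⟨refl ⟩
      T₁ γ ∘ (τ[ g ] • τ[ f ]) ∘ γ                  ≈⟨ refl⟩∘⟨ •-∘ ⟩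
      T₁ γ ∘ (τ[ g ] • (τ[ f ] ∘ γ))                ≈⟨ T₁-• ⟩
      (T₁ γ ∘ τ[ g ]) • (τ[ f ] ∘ γ)                ≈⟨ •-resp-≈ (pullʳ (cancelʳ commutative)) ≈-refl ⟨
      ((T₁ γ ∘ τ[ g ] ∘ γ) ∘ γ) • (τ[ f ] ∘ γ)      ≈⟨ •-T₁ ⟨
      (T₁ γ ∘ τ[ g ] ∘ γ) • (T₁ γ ∘ τ[ f ] ∘ γ)     ≈⟨ •-resp-≈ τ'[]-via-τ[] τ'[]-via-τ[] ⟨
      τ'[ g ] • τ'[ f ]                             ∎

    τ'[]-pure : ∀ {A B X} {h : B ⇒ X} → τ'[_] {A} (η ∘ h) ≈ η ∘ (h ⊗₁ id)
    τ'[]-pure {h = h} = begin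
      τ'[ η ∘ h ]                    ≈⟨ τ'[]-via-τ[] ⟩
      T₁ γ ∘ τ[ η ∘ h ] ∘ γ          ≈⟨ refl⟩∘⟨ τ[]-pure ⟩∘⟨refl ⟩
      T₁ γ ∘ (η ∘ (id ⊗₁ h)) ∘ γ     ≈⟨ refl⟩∘⟨ assoc ⟩
      T₁ γ ∘ η ∘ (id ⊗₁ h) ∘ γ       ≈⟨ extendʳ η-natural ⟩
      η ∘ γ ∘ (id ⊗₁ h) ∘ γ          ≈⟨ refl⟩∘⟨ pullˡ (≈-sym braiding-natural) ⟩
      η ∘ ((h ⊗₁ id) ∘ γ) ∘ γ        ≈⟨ refl⟩∘⟨ cancelʳ commutative ⟩
      η ∘ (h ⊗₁ id)                  ∎

    τ'-naturalʳ : ∀ {X Y Y'} {h : Y ⇒ Y'} → τ' C T {X} ∘ (id ⊗₁ h) ≈ T₁ (id ⊗₁ h) ∘ τ' C T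
    τ'-naturalʳ {h = h} = begin
      (T₁ γ ∘ τ ∘ γ) ∘ (id ⊗₁ h)        ≈⟨ pullʳ assoc ⟩
      T₁ γ ∘ τ ∘ γ ∘ (id ⊗₁ h)          ≈⟨ refl⟩∘⟨ refl⟩∘⟨ braiding-natural ⟨
      T₁ γ ∘ τ ∘ (h ⊗₁ id) ∘ γ          ≈⟨ refl⟩∘⟨ extendʳ τ-naturalˡ ⟩
      T₁ γ ∘ T₁ (h ⊗₁ id) ∘ τ ∘ γ       ≈⟨ extendʳ T₁γ-natural ⟩
      T₁ (id ⊗₁ h) ∘ T₁ γ ∘ τ ∘ γ       ∎
      where
      T₁γ-natural : T₁ γ ∘ T₁ (h ⊗₁ id) ≈ T₁ (id ⊗₁ h) ∘ T₁ γ
      T₁γ-natural = ≈-trans (≈-sym T-homomorphism)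
                      (≈-trans (T-resp-≈ (≈-sym braiding-natural)) T-homomorphism)

    τ'[]-naturalʳ : ∀ {A A' B X} {f : B ⇒ F X} {h : A ⇒ A'} →
                    τ'[ f ] ∘ (id ⊗₁ h) ≈ T₁ (id ⊗₁ h) ∘ τ'[ f ]
    τ'[]-naturalʳ {f = f} {h} = begin
      (τ' C T ∘ (f ⊗₁ id)) ∘ (id ⊗₁ h)    ≈⟨ pullʳ ⊗-slide ⟩
      τ' C T ∘ (id ⊗₁ h) ∘ (f ⊗₁ id)      ≈⟨ extendʳ τ'-naturalʳ ⟩
      T₁ (id ⊗₁ h) ∘ τ'[ f ]              ∎

    T₁-associator-isoˡ : ∀ {A B D} → T₁ α⇐ ∘ T₁ (α⇒ {A} {B} {D}) ≈ id
    T₁-associator-isoˡ = ≈-trans (≈-sym T-homomorphism) (≈-trans (T-resp-≈ associator-isoˡ) T-identity)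

    τ-associator⁻¹ : ∀ {A B D} → τ {A} {B ⊗₀ D} ∘ (id ⊗₁ τ) ≈ T₁ α⇒ ∘ τ ∘ α⇐
    τ-associator⁻¹ = begin
      τ ∘ (id ⊗₁ τ)                  ≈⟨ cancelʳ associator-isoʳ ⟨
      ((τ ∘ (id ⊗₁ τ)) ∘ α⇒) ∘ α⇐    ≈⟨ ≈-trans assoc (≈-sym τ-associator) ⟩∘⟨refl ⟩
      (T₁ α⇒ ∘ τ) ∘ α⇐               ≈⟨ assoc ⟩
      T₁ α⇒ ∘ τ ∘ α⇐                 ∎

    τ[]-associator : ∀ {A B D Y} {k : D ⇒ F Y} → T₁ α⇒ ∘ τ[_] {A ⊗₀ B} k ≈ τ[_] {A} (τ[_] {B} k) ∘ α⇒
    τ[]-associator {k = k} = begin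
      T₁ α⇒ ∘ τ ∘ (id ⊗₁ k)                    ≈⟨ pullˡ τ-associator ⟩
      (τ ∘ (id ⊗₁ τ) ∘ α⇒) ∘ (id ⊗₁ k)         ≈⟨ pullʳ (pullʳ associator-naturalʳ) ⟩
      τ ∘ (id ⊗₁ τ) ∘ (id ⊗₁ (id ⊗₁ k)) ∘ α⇒   ≈⟨ refl⟩∘⟨ pullˡ (≈-sym id⊗-∘) ⟩
      τ ∘ (id ⊗₁ τ[ k ]) ∘ α⇒                  ≈⟨ sym-assoc ⟩
      τ[ τ[ k ] ] ∘ α⇒                         ∎

    τ'-τ-associator : ∀ {A X Y} →
                      T₁ α⇒ ∘ τ' C T {A ⊗₀ X} {Y} ∘ (τ ⊗₁ id) ≈ τ ∘ (id ⊗₁ τ' C T) ∘ α⇒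
    τ'-τ-associator {A} {X} {Y} = ≈-trans lhs (≈-sym rhs)
      where
      T₁-hexagon : T₁ α⇒ ∘ T₁ γ ∘ T₁ α⇒ ≈ T₁ (id ⊗₁ γ) ∘ T₁ α⇒ ∘ T₁ (γ {Y} {A} ⊗₁ id {X})
      T₁-hexagon = ≈-trans (≈-sym T-homomorphism₃) (≈-trans (T-resp-≈ hexagon) T-homomorphism₃)

      common : ((A ⊗₀ F X) ⊗₀ Y) ⇒ F (A ⊗₀ (X ⊗₀ Y))
      common = T₁ (id ⊗₁ γ) ∘ T₁ α⇒ ∘ τ ∘ α⇐ ∘ (id ⊗₁ γ) ∘ α⇒

      lhs : T₁ α⇒ ∘ τ' C T ∘ (τ ⊗₁ id) ≈ common
      lhs = begin
        T₁ α⇒ ∘ (T₁ γ ∘ τ ∘ γ) ∘ (τ ⊗₁ id)                ≈⟨ refl⟩∘⟨ pullʳ assoc ⟩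
        T₁ α⇒ ∘ T₁ γ ∘ τ ∘ γ ∘ (τ ⊗₁ id)                  ≈⟨ refl⟩∘⟨ refl⟩∘⟨ refl⟩∘⟨ braiding-natural ⟨
        T₁ α⇒ ∘ T₁ γ ∘ τ ∘ (id ⊗₁ τ) ∘ γ                  ≈⟨ refl⟩∘⟨ refl⟩∘⟨ pullˡ τ-associator⁻¹ ⟩
        T₁ α⇒ ∘ T₁ γ ∘ (T₁ α⇒ ∘ τ ∘ α⇐) ∘ γ               ≈⟨ refl⟩∘⟨ refl⟩∘⟨ pullʳ assoc ⟩
        T₁ α⇒ ∘ T₁ γ ∘ T₁ α⇒ ∘ τ ∘ α⇐ ∘ γ                 ≈⟨ extend₃ T₁-hexagon ⟩
        T₁ (id ⊗₁ γ) ∘ T₁ α⇒ ∘ T₁ (γ ⊗₁ id) ∘ τ ∘ α⇐ ∘ γ  ≈⟨ refl⟩∘⟨ refl⟩∘⟨ extendʳ τ-naturalˡ ⟨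
        T₁ (id ⊗₁ γ) ∘ T₁ α⇒ ∘ τ ∘ (γ ⊗₁ id) ∘ α⇐ ∘ γ     ≈⟨ refl⟩∘⟨ refl⟩∘⟨ refl⟩∘⟨ hexagon-α⇐ ⟩
        common                                            ∎

      rhs : τ ∘ (id ⊗₁ τ' C T) ∘ α⇒ ≈ common
      rhs = begin
        τ ∘ (id ⊗₁ (T₁ γ ∘ τ ∘ γ)) ∘ α⇒                   ≈⟨ refl⟩∘⟨ ≈-trans id⊗-∘ (refl⟩∘⟨ id⊗-∘) ⟩∘⟨refl ⟩
        τ ∘ ((id ⊗₁ T₁ γ) ∘ (id ⊗₁ τ) ∘ (id ⊗₁ γ)) ∘ α⇒   ≈⟨ refl⟩∘⟨ pullʳ assoc ⟩
        τ ∘ (id ⊗₁ T₁ γ) ∘ (id ⊗₁ τ) ∘ (id ⊗₁ γ) ∘ α⇒     ≈⟨ extendʳ (≈-sym τ-natural) ⟩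
        T₁ (id ⊗₁ γ) ∘ τ ∘ (id ⊗₁ τ) ∘ (id ⊗₁ γ) ∘ α⇒     ≈⟨ refl⟩∘⟨ pullˡ τ-associator⁻¹ ⟩
        T₁ (id ⊗₁ γ) ∘ (T₁ α⇒ ∘ τ ∘ α⇐) ∘ (id ⊗₁ γ) ∘ α⇒  ≈⟨ refl⟩∘⟨ pullʳ assoc ⟩
        common                                            ∎

    τ'[]-τ[]-associator : ∀ {A B X Y} {f : B ⇒ F X} →
                          T₁ α⇒ ∘ τ'[_] {Y} (τ[_] {A} f) ≈ τ[ τ'[ f ] ] ∘ α⇒
    τ'[]-τ[]-associator {f = f} = begin
      T₁ α⇒ ∘ τ' C T ∘ (τ[ f ] ⊗₁ id)                  ≈⟨ refl⟩∘⟨ refl⟩∘⟨ ∘-⊗id ⟩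
      T₁ α⇒ ∘ τ' C T ∘ (τ ⊗₁ id) ∘ ((id ⊗₁ f) ⊗₁ id)   ≈⟨ assoc₃⁻ ⟩
      (T₁ α⇒ ∘ τ' C T ∘ (τ ⊗₁ id)) ∘ ((id ⊗₁ f) ⊗₁ id) ≈⟨ τ'-τ-associator ⟩∘⟨refl ⟩
      (τ ∘ (id ⊗₁ τ' C T) ∘ α⇒) ∘ ((id ⊗₁ f) ⊗₁ id)    ≈⟨ pullʳ (pullʳ (≈-sym associator-natural)) ⟩
      τ ∘ (id ⊗₁ τ' C T) ∘ (id ⊗₁ (f ⊗₁ id)) ∘ α⇒      ≈⟨ refl⟩∘⟨ pullˡ (≈-sym id⊗-∘) ⟩
      τ ∘ (id ⊗₁ τ'[ f ]) ∘ α⇒                         ≈⟨ sym-assoc ⟩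
      τ[ τ'[ f ] ] ∘ α⇒                                ∎

  module Centrality {F : Obj → Obj} (T : StrongMonadOn C F) where
    open StrongMonadOn T
    open Kleisli T
    open Strength T

    -- Equivalent to the cone condition, which only asks this for k = id, but visibly closed
    -- under Kleisli composition.
    IsCentral : ∀ {A X} → A ⇒ F X → Set (o ⊔ ℓ ⊔ e)
    IsCentral f = ∀ {B Y} (k : B ⇒ F Y) → τ'[ f ] • τ[ k ] ≈ τ[ k ] • τ'[ f ]

    IsCentral-resp-≈ : ∀ {A X} {f g : A ⇒ F X} → f ≈ g → IsCentral f → IsCentral g
    IsCentral-resp-≈ {f = f} {g} f≈g central k = begin
      τ'[ g ] • τ[ k ] ≈⟨ •-resp-≈ (τ'[]-resp-≈ f≈g) ≈-refl ⟨
      τ'[ f ] • τ[ k ] ≈⟨ central k ⟩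
      τ[ k ] • τ'[ f ] ≈⟨ •-resp-≈ ≈-refl (τ'[]-resp-≈ f≈g) ⟩
      τ[ k ] • τ'[ g ] ∎

    central-cone-lhs : ∀ {A X Y} {f : A ⇒ F X} →
                       μ ∘ T₁ (τ' C T {X} {Y}) ∘ τ ∘ (f ⊗₁ id) ≈ τ'[ f ] • τ[ id ]
    central-cone-lhs {f = f} = begin
      τ' C T • (τ ∘ (f ⊗₁ id))            ≈⟨ •-resp-≈ ≈-refl (τ[id] ⟩∘⟨refl) ⟨
      τ' C T • (τ[ id ] ∘ (f ⊗₁ id))      ≈⟨ •-resp-≈ ≈-refl τ[]-naturalˡ ⟩
      τ' C T • (T₁ (f ⊗₁ id) ∘ τ[ id ])   ≈⟨ •-T₁ ⟩
      τ'[ f ] • τ[ id ]                   ∎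

    central-cone-rhs : ∀ {A X Y} {f : A ⇒ F X} →
                       μ ∘ T₁ (τ {X} {Y}) ∘ τ' C T ∘ (f ⊗₁ id) ≈ τ[ id ] • τ'[ f ]
    central-cone-rhs = •-resp-≈ (≈-sym τ[id]) ≈-refl

    IsCentral⇒IsCentralCone : ∀ {A X} {f : A ⇒ F X} → IsCentral f → IsCentralCone C T X A f
    IsCentral⇒IsCentralCone central Y =
      ≈-trans central-cone-lhs (≈-trans (central (id {F Y})) (≈-sym central-cone-rhs))

    IsCentralCone⇒IsCentral : ∀ {A X} {f : A ⇒ F X} → IsCentralCone C T X A f → IsCentral f
    IsCentralCone⇒IsCentral {f = f} cone {Y = Y} k = begin
      τ'[ f ] • τ[ k ]                                ≈⟨ •-resp-≈ ≈-refl τ[]-via-τ[id] ⟩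
      τ'[ f ] • (τ[ id ] ∘ (id ⊗₁ k))                 ≈⟨ •-∘ ⟨
      (τ'[ f ] • τ[ id ]) ∘ (id ⊗₁ k)                 ≈⟨ central-cone-lhs ⟩∘⟨refl ⟨
      (μ ∘ T₁ (τ' C T) ∘ τ ∘ (f ⊗₁ id)) ∘ (id ⊗₁ k)   ≈⟨ cone Y ⟩∘⟨refl ⟩
      (μ ∘ T₁ τ ∘ τ' C T ∘ (f ⊗₁ id)) ∘ (id ⊗₁ k)     ≈⟨ central-cone-rhs ⟩∘⟨refl ⟩
      (τ[ id ] • τ'[ f ]) ∘ (id ⊗₁ k)                 ≈⟨ •-∘ ⟩
      τ[ id ] • (τ'[ f ] ∘ (id ⊗₁ k))                 ≈⟨ •-resp-≈ ≈-refl τ'[]-naturalʳ ⟩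
      τ[ id ] • (T₁ (id ⊗₁ k) ∘ τ'[ f ])              ≈⟨ •-T₁ ⟩
      (τ[ id ] ∘ (id ⊗₁ k)) • τ'[ f ]                 ≈⟨ •-resp-≈ τ[]-via-τ[id] ≈-refl ⟨
      τ[ k ] • τ'[ f ]                                ∎

    pure-central : ∀ {A X} (h : A ⇒ X) → IsCentral (η ∘ h)
    pure-central h k = begin
      τ'[ η ∘ h ] • τ[ k ]       ≈⟨ •-resp-≈ τ'[]-pure ≈-refl ⟩
      (η ∘ (h ⊗₁ id)) • τ[ k ]   ≈⟨ pure-• ⟩
      T₁ (h ⊗₁ id) ∘ τ[ k ]      ≈⟨ τ[]-naturalˡ ⟨
      τ[ k ] ∘ (h ⊗₁ id)         ≈⟨ •-pure ⟨
      τ[ k ] • (η ∘ (h ⊗₁ id))   ≈⟨ •-resp-≈ ≈-refl τ'[]-pure ⟨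
      τ[ k ] • τ'[ η ∘ h ]       ∎

    η-central : ∀ {X} → IsCentral (η {X})
    η-central = IsCentral-resp-≈ identityʳ (pure-central id)

    •-central : ∀ {A B X} {g : B ⇒ F X} {f : A ⇒ F B} → IsCentral g → IsCentral f → IsCentral (g • f)
    •-central {g = g} {f} g-central f-central k = begin
      τ'[ g • f ] • τ[ k ]            ≈⟨ •-resp-≈ τ'[]-• ≈-refl ⟩
      (τ'[ g ] • τ'[ f ]) • τ[ k ]    ≈⟨ •-assoc ⟩
      τ'[ g ] • (τ'[ f ] • τ[ k ])    ≈⟨ •-resp-≈ ≈-refl (f-central k) ⟩
      τ'[ g ] • (τ[ k ] • τ'[ f ])    ≈⟨ •-assoc ⟨
      (τ'[ g ] • τ[ k ]) • τ'[ f ]    ≈⟨ •-resp-≈ (g-central k) ≈-refl ⟩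
      (τ[ k ] • τ'[ g ]) • τ'[ f ]    ≈⟨ •-assoc ⟩
      τ[ k ] • (τ'[ g ] • τ'[ f ])    ≈⟨ •-resp-≈ ≈-refl τ'[]-• ⟨
      τ[ k ] • τ'[ g • f ]            ∎

    ∘-central : ∀ {A A' X} {f : A ⇒ F X} {h : A' ⇒ A} → IsCentral f → IsCentral (f ∘ h)
    ∘-central {h = h} central = IsCentral-resp-≈ •-pure (•-central central (pure-central h))

    T₁-central : ∀ {A X Y} {g : X ⇒ Y} {f : A ⇒ F X} → IsCentral f → IsCentral (T₁ g ∘ f)
    T₁-central {g = g} central = IsCentral-resp-≈ pure-• (•-central (pure-central g) central)

    τ[]-central : ∀ {A B X} {f : B ⇒ F X} → IsCentral f → IsCentral (τ[_] {A} f)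
    τ[]-central {A} {f = f} central {D} {Y} k = split-mono T₁-associator-isoˡ (begin
      T₁ α⇒ ∘ (τ'[ τ[ f ] ] • τ[ k ])  ≈⟨ α-τ'[]•τ[] ⟩
      τ[ τ'[ f ] • τ[ k ] ] ∘ α⇒       ≈⟨ τ[]-resp-≈ (central k) ⟩∘⟨refl ⟩
      τ[ τ[ k ] • τ'[ f ] ] ∘ α⇒       ≈⟨ α-τ[]•τ'[] ⟨
      T₁ α⇒ ∘ (τ[ k ] • τ'[ τ[ f ] ])  ∎)
      where
      α-τ'[]•τ[] : T₁ α⇒ ∘ (τ'[ τ[_] {A} f ] • τ[ k ]) ≈ τ[ τ'[ f ] • τ[ k ] ] ∘ α⇒
      α-τ'[]•τ[] = begin
        T₁ α⇒ ∘ (τ'[ τ[ f ] ] • τ[ k ])     ≈⟨ T₁-• ⟩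
        (T₁ α⇒ ∘ τ'[ τ[ f ] ]) • τ[ k ]     ≈⟨ •-resp-≈ τ'[]-τ[]-associator ≈-refl ⟩
        (τ[ τ'[ f ] ] ∘ α⇒) • τ[ k ]        ≈⟨ •-T₁ ⟨
        τ[ τ'[ f ] ] • (T₁ α⇒ ∘ τ[ k ])     ≈⟨ •-resp-≈ ≈-refl τ[]-associator ⟩
        τ[ τ'[ f ] ] • (τ[ τ[ k ] ] ∘ α⇒)   ≈⟨ •-∘ ⟨
        (τ[ τ'[ f ] ] • τ[ τ[ k ] ]) ∘ α⇒   ≈⟨ τ[]-• ⟩∘⟨refl ⟨
        τ[ τ'[ f ] • τ[ k ] ] ∘ α⇒          ∎

      α-τ[]•τ'[] : T₁ α⇒ ∘ (τ[ k ] • τ'[ τ[_] {A} f ]) ≈ τ[ τ[ k ] • τ'[ f ] ] ∘ α⇒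
      α-τ[]•τ'[] = begin
        T₁ α⇒ ∘ (τ[ k ] • τ'[ τ[ f ] ])     ≈⟨ T₁-• ⟩
        (T₁ α⇒ ∘ τ[ k ]) • τ'[ τ[ f ] ]     ≈⟨ •-resp-≈ τ[]-associator ≈-refl ⟩
        (τ[ τ[ k ] ] ∘ α⇒) • τ'[ τ[ f ] ]   ≈⟨ •-T₁ ⟨
        τ[ τ[ k ] ] • (T₁ α⇒ ∘ τ'[ τ[ f ] ]) ≈⟨ •-resp-≈ ≈-refl τ'[]-τ[]-associator ⟩
        τ[ τ[ k ] ] • (τ[ τ'[ f ] ] ∘ α⇒)   ≈⟨ •-∘ ⟨
        (τ[ τ[ k ] ] • τ[ τ'[ f ] ]) ∘ α⇒   ≈⟨ τ[]-• ⟩∘⟨refl ⟨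
        τ[ τ[ k ] • τ'[ f ] ] ∘ α⇒          ∎

  module CentreMonad {F : Obj → Obj} (T : StrongMonadOn C F)
                     (Z : Obj → Obj) (ι : ∀ X → Z X ⇒ F X)
                     (terminal : ∀ X → IsTerminalCentralCone C T X (Z X) (ι X)) where
    open StrongMonadOn T
    open Kleisli T
    open Strength T
    open Centrality T

    ι-central : ∀ X → IsCentral (ι X)
    ι-central X = IsCentralCone⇒IsCentral (proj₁ (terminal X))

    factor : ∀ {X W} (h : W ⇒ F X) → IsCentral h → W ⇒ Z X
    factor {X} {W} h central = proj₁ (proj₂ (terminal X) W h (IsCentral⇒IsCentralCone central))

    ι-factor : ∀ {X W} {h : W ⇒ F X} (central : IsCentral h) → ι X ∘ factor h central ≈ h
    ι-factor {X} {W} {h} central =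
      proj₁ (proj₂ (proj₂ (terminal X) W h (IsCentral⇒IsCentralCone central)))

    factor-unique : ∀ {X W} {h : W ⇒ F X} (central : IsCentral h) {ψ : W ⇒ Z X} →
                    ι X ∘ ψ ≈ h → ψ ≈ factor h central
    factor-unique {X} {W} {h} central =
      proj₂ (proj₂ (proj₂ (terminal X) W h (IsCentral⇒IsCentralCone central))) _

    ι-mono : ∀ {X W} {p q : W ⇒ Z X} → ι X ∘ p ≈ ι X ∘ q → p ≈ q
    ι-mono {X} {q = q} ιp≈ιq =
      ≈-trans (factor-unique ιq-central ιp≈ιq) (≈-sym (factor-unique ιq-central ≈-refl))
      where
      ιq-central : IsCentral (ι X ∘ q)
      ιq-central = ∘-central (ι-central X)

    Z₁ : ∀ {A B} → A ⇒ B → Z A ⇒ Z B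
    Z₁ {A} f = factor (T₁ f ∘ ι A) (T₁-central (ι-central A))

    ι-natural : ∀ {A B} {f : A ⇒ B} → ι B ∘ Z₁ f ≈ T₁ f ∘ ι A
    ι-natural {A} = ι-factor (T₁-central (ι-central A))

    ηᶻ : ∀ {A} → A ⇒ Z A
    ηᶻ = factor η η-central

    ι-η : ∀ {A} → ι A ∘ ηᶻ ≈ η
    ι-η = ι-factor η-central

    μᶻ : ∀ {A} → Z (Z A) ⇒ Z A
    μᶻ {A} = factor (ι A • ι (Z A)) (•-central (ι-central A) (ι-central (Z A)))

    ι-μ : ∀ {A} → ι A ∘ μᶻ ≈ ι A • ι (Z A)
    ι-μ {A} = ι-factor (•-central (ι-central A) (ι-central (Z A)))

    τᶻ : ∀ {A B} → (A ⊗₀ Z B) ⇒ Z (A ⊗₀ B)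
    τᶻ {A} {B} = factor (τ[_] {A} (ι B)) (τ[]-central (ι-central B))

    ι-τ : ∀ {A B} → ι (A ⊗₀ B) ∘ τᶻ ≈ τ[ ι B ]
    ι-τ {B = B} = ι-factor (τ[]-central (ι-central B))

    ι-μ-Z₁ : ∀ {X V} {a : V ⇒ Z X} → ι X ∘ μᶻ ∘ Z₁ a ≈ (ι X ∘ a) • ι V
    ι-μ-Z₁ {X} {V} {a} = begin
      ι X ∘ μᶻ ∘ Z₁ a          ≈⟨ pullˡ ι-μ ⟩
      (ι X • ι (Z X)) ∘ Z₁ a   ≈⟨ •-∘ ⟩
      ι X • (ι (Z X) ∘ Z₁ a)   ≈⟨ •-resp-≈ ≈-refl ι-natural ⟩
      ι X • (T₁ a ∘ ι V)       ≈⟨ •-T₁ ⟩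
      (ι X ∘ a) • ι V          ∎

    ι-μ-Z₁-∘ : ∀ {X V W} {a : V ⇒ Z X} {b : W ⇒ Z V} → ι X ∘ μᶻ ∘ Z₁ a ∘ b ≈ (ι X ∘ a) • (ι V ∘ b)
    ι-μ-Z₁-∘ = ≈-trans assoc₃⁻ (≈-trans (ι-μ-Z₁ ⟩∘⟨refl) •-∘)

    Z-identity : ∀ {A} → Z₁ (id {A}) ≈ id
    Z-identity {A} = ι-mono (begin
      ι A ∘ Z₁ id     ≈⟨ ι-natural ⟩
      T₁ id ∘ ι A     ≈⟨ T-identity ⟩∘⟨refl ⟩
      id ∘ ι A        ≈⟨ identityˡ ⟩
      ι A             ≈⟨ identityʳ ⟨
      ι A ∘ id        ∎)

    Z-homomorphism : ∀ {A B D} {f : A ⇒ B} {g : B ⇒ D} → Z₁ (g ∘ f) ≈ Z₁ g ∘ Z₁ f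
    Z-homomorphism {A} {B} {D} {f} {g} = ι-mono (begin
      ι D ∘ Z₁ (g ∘ f)       ≈⟨ ι-natural ⟩
      T₁ (g ∘ f) ∘ ι A       ≈⟨ T-homomorphism ⟩∘⟨refl ⟩
      (T₁ g ∘ T₁ f) ∘ ι A    ≈⟨ assoc ⟩
      T₁ g ∘ T₁ f ∘ ι A      ≈⟨ refl⟩∘⟨ ι-natural ⟨
      T₁ g ∘ ι B ∘ Z₁ f      ≈⟨ extendʳ ι-natural ⟨
      ι D ∘ Z₁ g ∘ Z₁ f      ∎)

    Z-resp-≈ : ∀ {A B} {f g : A ⇒ B} → f ≈ g → Z₁ f ≈ Z₁ g
    Z-resp-≈ f≈g = ι-mono (≈-trans ι-natural (≈-trans (T-resp-≈ f≈g ⟩∘⟨refl) (≈-sym ι-natural)))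

    ηᶻ-natural : ∀ {A B} {f : A ⇒ B} → Z₁ f ∘ ηᶻ ≈ ηᶻ ∘ f
    ηᶻ-natural {A} {B} {f} = ι-mono (begin
      ι B ∘ Z₁ f ∘ ηᶻ    ≈⟨ extendʳ ι-natural ⟩
      T₁ f ∘ ι A ∘ ηᶻ    ≈⟨ refl⟩∘⟨ ι-η ⟩
      T₁ f ∘ η           ≈⟨ η-natural ⟩
      η ∘ f              ≈⟨ pullˡ ι-η ⟨
      ι B ∘ ηᶻ ∘ f       ∎)

    μᶻ-natural : ∀ {A B} {f : A ⇒ B} → Z₁ f ∘ μᶻ ≈ μᶻ ∘ Z₁ (Z₁ f)
    μᶻ-natural {A} {B} {f} = ι-mono (begin
      ι B ∘ Z₁ f ∘ μᶻ               ≈⟨ extendʳ ι-natural ⟩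
      T₁ f ∘ ι A ∘ μᶻ               ≈⟨ refl⟩∘⟨ ι-μ ⟩
      T₁ f ∘ (ι A • ι (Z A))        ≈⟨ T₁-• ⟩
      (T₁ f ∘ ι A) • ι (Z A)        ≈⟨ •-resp-≈ ι-natural ≈-refl ⟨
      (ι B ∘ Z₁ f) • ι (Z A)        ≈⟨ ι-μ-Z₁ ⟨
      ι B ∘ μᶻ ∘ Z₁ (Z₁ f)          ∎)

    μᶻ-assoc : ∀ {A} → μᶻ {A} ∘ Z₁ μᶻ ≈ μᶻ ∘ μᶻ
    μᶻ-assoc {A} = ι-mono (begin
      ι A ∘ μᶻ ∘ Z₁ μᶻ                   ≈⟨ ι-μ-Z₁ ⟩
      (ι A ∘ μᶻ) • ι (Z (Z A))           ≈⟨ •-resp-≈ ι-μ ≈-refl ⟩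
      (ι A • ι (Z A)) • ι (Z (Z A))      ≈⟨ •-assoc ⟩
      ι A • (ι (Z A) • ι (Z (Z A)))      ≈⟨ •-resp-≈ ≈-refl ι-μ ⟨
      ι A • (ι (Z A) ∘ μᶻ)               ≈⟨ •-∘ ⟨
      (ι A • ι (Z A)) ∘ μᶻ               ≈⟨ pullˡ ι-μ ⟨
      ι A ∘ μᶻ ∘ μᶻ                      ∎)

    μᶻ-identityˡ : ∀ {A} → μᶻ {A} ∘ Z₁ ηᶻ ≈ id
    μᶻ-identityˡ {A} = ι-mono (begin
      ι A ∘ μᶻ ∘ Z₁ ηᶻ     ≈⟨ ι-μ-Z₁ ⟩
      (ι A ∘ ηᶻ) • ι A     ≈⟨ •-resp-≈ ι-η ≈-refl ⟩
      η • ι A              ≈⟨ •-identityˡ ⟩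
      ι A                  ≈⟨ identityʳ ⟨
      ι A ∘ id             ∎)

    μᶻ-identityʳ : ∀ {A} → μᶻ {A} ∘ ηᶻ ≈ id
    μᶻ-identityʳ {A} = ι-mono (begin
      ι A ∘ μᶻ ∘ ηᶻ            ≈⟨ pullˡ ι-μ ⟩
      (ι A • ι (Z A)) ∘ ηᶻ     ≈⟨ •-∘ ⟩
      ι A • (ι (Z A) ∘ ηᶻ)     ≈⟨ •-resp-≈ ≈-refl ι-η ⟩
      ι A • η                  ≈⟨ •-identityʳ ⟩
      ι A                      ≈⟨ identityʳ ⟨
      ι A ∘ id                 ∎)

    τᶻ-natural : ∀ {A B D E} {f : A ⇒ D} {g : B ⇒ E} → Z₁ (f ⊗₁ g) ∘ τᶻ ≈ τᶻ ∘ (f ⊗₁ Z₁ g)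
    τᶻ-natural {A} {B} {D} {E} {f} {g} = ι-mono (begin
      ι (D ⊗₀ E) ∘ Z₁ (f ⊗₁ g) ∘ τᶻ     ≈⟨ extendʳ ι-natural ⟩
      T₁ (f ⊗₁ g) ∘ ι (A ⊗₀ B) ∘ τᶻ     ≈⟨ refl⟩∘⟨ ι-τ ⟩
      T₁ (f ⊗₁ g) ∘ τ ∘ (id ⊗₁ ι B)     ≈⟨ extendʳ τ-natural ⟩
      τ ∘ (f ⊗₁ T₁ g) ∘ (id ⊗₁ ι B)     ≈⟨ refl⟩∘⟨ interchange ⟩
      τ ∘ (id ⊗₁ ι E) ∘ (f ⊗₁ Z₁ g)     ≈⟨ sym-assoc ⟩
      τ[ ι E ] ∘ (f ⊗₁ Z₁ g)            ≈⟨ pullˡ ι-τ ⟨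
      ι (D ⊗₀ E) ∘ τᶻ ∘ (f ⊗₁ Z₁ g)     ∎)
      where
      interchange : (f ⊗₁ T₁ g) ∘ (id ⊗₁ ι B) ≈ (id ⊗₁ ι E) ∘ (f ⊗₁ Z₁ g)
      interchange = ≈-trans (≈-sym ⊗-homomorphism)
        (≈-trans (⊗-resp-≈ (≈-trans identityʳ (≈-sym identityˡ)) (≈-sym ι-natural)) ⊗-homomorphism)

    τᶻ-unitor : ∀ {A} → Z₁ unitorˡ⇒ ∘ τᶻ {unit} {A} ≈ unitorˡ⇒
    τᶻ-unitor {A} = ι-mono (begin
      ι A ∘ Z₁ unitorˡ⇒ ∘ τᶻ              ≈⟨ extendʳ ι-natural ⟩
      T₁ unitorˡ⇒ ∘ ι (unit ⊗₀ A) ∘ τᶻ    ≈⟨ refl⟩∘⟨ ι-τ ⟩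
      T₁ unitorˡ⇒ ∘ τ ∘ (id ⊗₁ ι A)       ≈⟨ pullˡ τ-unitor ⟩
      unitorˡ⇒ ∘ (id ⊗₁ ι A)              ≈⟨ unitorˡ-natural ⟨
      ι A ∘ unitorˡ⇒                      ∎)

    τᶻ-associator : ∀ {A B D} → Z₁ α⇒ ∘ τᶻ {A ⊗₀ B} {D} ≈ τᶻ ∘ (id ⊗₁ τᶻ) ∘ α⇒
    τᶻ-associator {A} {B} {D} = ι-mono (begin
      ι (A ⊗₀ (B ⊗₀ D)) ∘ Z₁ α⇒ ∘ τᶻ          ≈⟨ extendʳ ι-natural ⟩
      T₁ α⇒ ∘ ι ((A ⊗₀ B) ⊗₀ D) ∘ τᶻ          ≈⟨ refl⟩∘⟨ ι-τ ⟩
      T₁ α⇒ ∘ τ[ ι D ]                        ≈⟨ τ[]-associator ⟩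
      τ[ τ[ ι D ] ] ∘ α⇒                      ≈⟨ τ[]-resp-≈ ι-τ ⟩∘⟨refl ⟨
      τ[ ι (B ⊗₀ D) ∘ τᶻ ] ∘ α⇒               ≈⟨ τ[]-∘ ⟩∘⟨refl ⟨
      (τ[ ι (B ⊗₀ D) ] ∘ (id ⊗₁ τᶻ)) ∘ α⇒     ≈⟨ assoc ⟩
      τ[ ι (B ⊗₀ D) ] ∘ (id ⊗₁ τᶻ) ∘ α⇒       ≈⟨ pullˡ ι-τ ⟨
      ι (A ⊗₀ (B ⊗₀ D)) ∘ τᶻ ∘ (id ⊗₁ τᶻ) ∘ α⇒ ∎)

    τᶻ-ηᶻ : ∀ {A B} → τᶻ {A} {B} ∘ (id ⊗₁ ηᶻ) ≈ ηᶻ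
    τᶻ-ηᶻ {A} {B} = ι-mono (begin
      ι (A ⊗₀ B) ∘ τᶻ ∘ (id ⊗₁ ηᶻ)    ≈⟨ pullˡ ι-τ ⟩
      τ[ ι B ] ∘ (id ⊗₁ ηᶻ)           ≈⟨ τ[]-∘ ⟩
      τ[ ι B ∘ ηᶻ ]                   ≈⟨ τ[]-resp-≈ ι-η ⟩
      τ[ η ]                          ≈⟨ τ-η ⟩
      η                               ≈⟨ ι-η ⟨
      ι (A ⊗₀ B) ∘ ηᶻ                 ∎)

    τᶻ-μᶻ : ∀ {A B} → τᶻ {A} {B} ∘ (id ⊗₁ μᶻ) ≈ μᶻ ∘ Z₁ τᶻ ∘ τᶻ
    τᶻ-μᶻ {A} {B} = ι-mono (begin
      ι (A ⊗₀ B) ∘ τᶻ ∘ (id ⊗₁ μᶻ)                  ≈⟨ pullˡ ι-τ ⟩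
      τ[ ι B ] ∘ (id ⊗₁ μᶻ)                         ≈⟨ τ[]-∘ ⟩
      τ[ ι B ∘ μᶻ ]                                 ≈⟨ τ[]-resp-≈ ι-μ ⟩
      τ[ ι B • ι (Z B) ]                            ≈⟨ τ[]-• ⟩
      τ[ ι B ] • τ[ ι (Z B) ]                       ≈⟨ •-resp-≈ ι-τ ι-τ ⟨
      (ι (A ⊗₀ B) ∘ τᶻ) • (ι (A ⊗₀ Z B) ∘ τᶻ)       ≈⟨ ι-μ-Z₁-∘ ⟨
      ι (A ⊗₀ B) ∘ μᶻ ∘ Z₁ τᶻ ∘ τᶻ                  ∎)

    centre-monad : StrongMonadOn C Z
    centre-monad = record
      { T₁ = Z₁
      ; T-identity = Z-identity
      ; T-homomorphism = Z-homomorphism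
      ; T-resp-≈ = Z-resp-≈
      ; η = ηᶻ
      ; η-natural = ηᶻ-natural
      ; μ = μᶻ
      ; μ-natural = μᶻ-natural
      ; μ-assoc = μᶻ-assoc
      ; μ-identityˡ = μᶻ-identityˡ
      ; μ-identityʳ = μᶻ-identityʳ
      ; τ = τᶻ
      ; τ-natural = τᶻ-natural
      ; τ-unitor = τᶻ-unitor
      ; τ-associator = τᶻ-associator
      ; τ-η = τᶻ-ηᶻ
      ; τ-μ = τᶻ-μᶻ
      }

    ι-τ' : ∀ {X Y} → ι (X ⊗₀ Y) ∘ τ' C centre-monad {X} {Y} ≈ τ'[ ι X ]
    ι-τ' {X} {Y} = begin
      ι (X ⊗₀ Y) ∘ Z₁ γ ∘ τᶻ ∘ γ    ≈⟨ extendʳ ι-natural ⟩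
      T₁ γ ∘ ι (Y ⊗₀ X) ∘ τᶻ ∘ γ    ≈⟨ refl⟩∘⟨ pullˡ ι-τ ⟩
      T₁ γ ∘ τ[ ι X ] ∘ γ           ≈⟨ τ'[]-via-τ[] ⟨
      τ'[ ι X ]                     ∎

    centre-commutative : IsCommutativeMonad C centre-monad
    centre-commutative {X} {Y} = ι-mono (begin
      ι (X ⊗₀ Y) ∘ μᶻ ∘ Z₁ (τ' C centre-monad) ∘ τᶻ              ≈⟨ ι-μ-Z₁-∘ ⟩
      (ι (X ⊗₀ Y) ∘ τ' C centre-monad) • (ι (Z X ⊗₀ Y) ∘ τᶻ)     ≈⟨ •-resp-≈ ι-τ' ι-τ ⟩
      τ'[ ι X ] • τ[ ι Y ]                                       ≈⟨ ι-central X (ι Y) ⟩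
      τ[ ι Y ] • τ'[ ι X ]                                       ≈⟨ •-resp-≈ ι-τ ι-τ' ⟨
      (ι (X ⊗₀ Y) ∘ τᶻ) • (ι (X ⊗₀ Z Y) ∘ τ' C centre-monad)     ≈⟨ ι-μ-Z₁-∘ ⟨
      ι (X ⊗₀ Y) ∘ μᶻ ∘ Z₁ τᶻ ∘ τ' C centre-monad                ∎)

    ι-strong-monad-morphism : IsStrongMonadMorphism C centre-monad T ι
    ι-strong-monad-morphism = (λ _ → ≈-sym ι-natural) , ι-η , ι-μ , ι-τ

    ι-strong-monad-mono : IsStrongMonadMono C centre-monad T ι
    -- ι is monic componentwise.
    ι-strong-monad-mono _ _ _ _ _ ιf≈ιg X = ι-mono (ιf≈ιg X)

theorem2p6 : ∀ {o ℓ e} (C : SymmetricMonoidalCategory o ℓ e) →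
    let open SymmetricMonoidalCategory C in
    {F : Obj → Obj} (T : StrongMonadOn C F) →
    (Z : Obj → Obj) (ι : ∀ X → Z X ⇒ F X) →
    (∀ X → IsTerminalCentralCone C T X (Z X) (ι X)) →
    Σ (StrongMonadOn C Z) λ M →
      IsCommutativeMonad C M × IsStrongMonadMorphism C M T ι × IsStrongMonadMono C M T ι
theorem2p6 C T Z ι terminal =
  centre-monad , centre-commutative , ι-strong-monad-morphism , ι-strong-monad-mono
  where open CentreMonad C T Z ι terminal
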